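{- Let $\mathcal{F}$ be the free non-symmetric operad on two binary generators $\alpha,\beta$, and let $\pi:\mathcal{F}\to\mathrm{CNCB}$ be the operad morphism with $\pi(\alpha)=\tau_{aab}$ and $\pi(\beta)=\tau_{bab}$. Then $\pi$ induces an isomorphism from $\mathcal{F}/_{\equiv}$ onto the suboperad $\langle\tau_{aab},\tau_{bab}\rangle$, where $\equiv$ is the smallest operad congruence of $\mathcal{F}$ containing $\beta\circ_1\beta\equiv\beta\circ_2\beta$ and $\beta\circ_1\alpha\equiv\alpha\circ_2\beta$.
   Context: A bicoloured noncrossing configuration (BNC) of size $n\ge2$ is a regular polygon with vertices $1,\dots,n+1$ (clockwise) with each arc $(i,j)$, $1\le i<j\le n+1$, coloured blue, red or uncoloured, such that no two coloured (blue or red) arcs cross and red arcs are diagonals. The edges are $(i,i+1)$ for $i\in[n]$ (the $i$-th edge), the base is $(1,n+1)$, and the other arcs are diagonals. There is also a unique BNC of size $1$, a single blue arc (its edge and base). $\mathrm{CNCB}$ is the non-symmetric operad of BNCs (arity = size, unit = the size-$1$ BNC) with composition $\mathfrak{C}\circ_i\mathfrak{D}$ ($\mathfrak{C}$ of size $n$, $\mathfrak{D}$ of size $m$) obtained by gluing the base of $\mathfrak{D}$ onto the $i$-th edge of $\mathfrak{C}$. Vertex $j$ of $\mathfrak{C}$ goes to $j$ if $j\le i$ and to $j+m-1$ otherwise, and vertex $\ell$ of $\mathfrak{D}$ goes to $i+\ell-1$. All other arcs keep their colours. The arc $(i,i+m)$ is red if the $i$-th edge of $\mathfrak{C}$ and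 the base of $\mathfrak{D}$ are both uncoloured, blue if both are blue, and uncoloured otherwise. All remaining arcs are uncoloured. For $x,y,z\in\{a,b\}$, $\tau_{xyz}$ is the BNC of size $2$ (a triangle, which has no diagonals) whose first edge $(1,2)$, base $(1,3)$ and second edge $(2,3)$ are respectively coloured $x,y,z$, where $a$ means blue and $b$ means uncoloured. $\langle G\rangle$ denotes the smallest suboperad of $\mathrm{CNCB}$ containing $G$. -}

module Defs where

open import Data.Nat using (ℕ; zero; suc; _+_; _∸_; _≤_; _<_; _≤ᵇ_; _≡ᵇ_)
open import Data.Bool using (Bool; true; false; if_then_else_; _∧_; _∨_)
open import Data.Product using (_×_)
open import Data.Empty using (⊥)
open import Relation.Binary.PropositionalEquality using (_≡_; _≢_)

data Colour : Set where
  blue red uncol : Colour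

-- A (raw) colouring of size n: the polygon has vertices 1..n+1 and
-- col i j is the colour of the arc (i,j); only the values with
-- 1 ≤ i < j ≤ size + 1 are meaningful.
record Colouring : Set where
  constructor mkCol
  field
    size : ℕ
    col  : ℕ → ℕ → Colour
open Colouring public

Coloured : Colour → Set
Coloured c = c ≢ uncol

record IsBNC (C : Colouring) : Set where
  field
    size-pos   : 1 ≤ size C
    size-one   : size C ≡ 1 → col C 1 2 ≡ blue
    noncross   : ∀ i j k l → 1 ≤ i → i < k → k < j → j < l → l ≤ size C + 1 →
                 Coloured (col C i j) → Coloured (col C k l) → ⊥
    red-diag-e : ∀ i → 1 ≤ i → i ≤ size C → col C i (suc i) ≢ red
    red-diag-b : col C 1 (size C + 1) ≢ red

_≐_ : Colouring → Colouring → Set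
C ≐ D = (size C ≡ size D) ×
        (∀ p q → 1 ≤ p → p < q → q ≤ size C + 1 → col C p q ≡ col D p q)

glue : Colour → Colour → Colour
glue uncol uncol = red
glue blue  blue  = blue
glue _     _     = uncol

-- C ∘_i D : glue the base of D onto the i-th edge of C.
compose : Colouring → ℕ → Colouring → Colouring
compose C i D = mkCol (size C + size D ∸ 1) colour
  where
  m = size D
  inD : ℕ → Bool
  inD p = (i ≤ᵇ p) ∧ (p ≤ᵇ i + m)
  inC : ℕ → Bool
  inC p = (p ≤ᵇ i) ∨ (i + m ≤ᵇ p)
  backC : ℕ → ℕ          -- inverse of j ↦ j (j ≤ i), j + m - 1 (j > i)
  backC p = if p ≤ᵇ i then p else p ∸ (m ∸ 1)
  backD : ℕ → ℕ          -- inverse of ℓ ↦ i + ℓ - 1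
  backD p = suc (p ∸ i)
  colour : ℕ → ℕ → Colour
  colour p q =
    if (p ≡ᵇ i) ∧ (q ≡ᵇ i + m) then glue (col C i (suc i)) (col D 1 (suc m))
    else if inD p ∧ inD q then col D (backD p) (backD q)
    else if inC p ∧ inC q then col C (backC p) (backC q)
    else uncol

unitC : Colouring
unitC = mkCol 1 λ { 1 2 → blue ; _ _ → uncol }

-- τ_{xyz}: first edge (1,2) coloured x, base (1,3) coloured y,
-- second edge (2,3) coloured z  (a = blue, b = uncoloured).
τ : Colour → Colour → Colour → Colouring
τ x y z = mkCol 2 λ { 1 2 → x ; 1 3 → y ; 2 3 → z ; _ _ → uncol }

τaab τbab : Colouring
τaab = τ blue blue uncol
τbab = τ uncol blue uncol

data InGen : Colouring → Set where
  g-unit : InGen unitC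
  g-aab  : InGen τaab
  g-bab  : InGen τbab
  g-comp : ∀ {C D} i → InGen C → InGen D → 1 ≤ i → i ≤ size C →
           InGen (compose C i D)

data Gen₂ : Set where
  α β : Gen₂

data Tree : Set where
  leaf : Tree
  node : Gen₂ → Tree → Tree → Tree

arity : Tree → ℕ
arity leaf         = 1
arity (node _ l r) = arity l + arity r

graft : Tree → ℕ → Tree → Tree
graft leaf         i t = t
graft (node g l r) i t =
  if i ≤ᵇ arity l then node g (graft l i t) r
  else node g l (graft r (i ∸ arity l) t)

gen : Gen₂ → Tree
gen g = node g leaf leaf

infix 4 _≈_
data _≈_ : Tree → Tree → Set where
  rel₁   : graft (gen β) 1 (gen β) ≈ graft (gen β) 2 (gen β)
  rel₂   : graft (gen β) 1 (gen α) ≈ graft (gen α) 2 (gen β)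
  ≈-refl : ∀ {s} → s ≈ s
  ≈-sym  : ∀ {s t} → s ≈ t → t ≈ s
  ≈-trans : ∀ {s t u} → s ≈ t → t ≈ u → s ≈ u
  ≈-comp : ∀ {s s' t t'} i → s ≈ s' → t ≈ t' → 1 ≤ i → i ≤ arity s →
           graft s i t ≈ graft s' i t'

πgen : Gen₂ → Colouring
πgen α = τaab
πgen β = τbab

π : Tree → Colouring
π leaf         = unitC
π (node g l r) = compose (compose (πgen g) 2 (π r)) 1 (π l)

{-# OPTIONS --safe #-}
module Submission where

-- Every arc of C ∘ᵢ D is the glued arc, an arc of D, an arc of C, or an uncoloured arc
-- crossing the boundary of the glued span. Applied to π (node g l r) = (πgen g ∘₂ π r) ∘₁ π l,
-- this expresses the colours of π of a node through π l and π r; comparing the two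
-- descriptions by induction on s gives π (s ∘ᵢ t) ≐ π s ∘ᵢ π t. Hence π is an operad
-- morphism, its image is ⟨τaab, τbab⟩, and it respects ≈ because it identifies both
-- sides of the two relations.
--
-- For faithfulness, orient the relations as β (β x y) z ↦ β x (β y z) and
-- β (α x y) z ↦ α x (β y z); the normal forms are leaf, β leaf x and α x y. A normal form
-- is read off from its image: among the arcs (1, k+1) with k at least the arity of the
-- left subtree, only k = that arity can be blue, and it is blue exactly for α. This
-- determines the root generator and the split, and the subtrees are recovered recursively.

open import Defs
open import Data.Bool using (Bool; true; false; T; _∧_)
open import Data.Bool.Properties using (∧-zeroʳ; T-≡)
open import Data.Nat
open import Data.Nat.Properties
open import Algebra.Properties.CommutativeSemigroup +-commutativeSemigroup using (xy∙z≈xz∙y)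
open import Data.Product using (_×_; ∃; _,_; proj₁; proj₂)
open import Data.Sum using (_⊎_; inj₁; inj₂)
open import Function.Bundles using (Equivalence)
open import Relation.Binary.PropositionalEquality
open import Relation.Nullary using (¬_; yes; no; Dec; contradiction)
open import Relation.Nullary.Decidable using (_×-dec_)

-- Colours of a composition

≡ᵇ-refl : ∀ n → (n ≡ᵇ n) ≡ true
≡ᵇ-refl n = Equivalence.to T-≡ (≡⇒≡ᵇ n n refl)

≢⇒≡ᵇ-false : ∀ {m n} → m ≢ n → (m ≡ᵇ n) ≡ false
≢⇒≡ᵇ-false {m} {n} m≢n with m ≡ᵇ n in eq
... | false = refl
... | true  = contradiction (≡ᵇ⇒≡ m n (subst T (sym eq) _)) m≢n

≤⇒≤ᵇ-true : ∀ {m n} → m ≤ n → (m ≤ᵇ n) ≡ true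
≤⇒≤ᵇ-true m≤n = Equivalence.to T-≡ (≤⇒≤ᵇ m≤n)

>⇒≤ᵇ-false : ∀ {m n} → n < m → (m ≤ᵇ n) ≡ false
>⇒≤ᵇ-false {m} {n} n<m with m ≤ᵇ n in eq
... | false = refl
... | true  = contradiction (≤ᵇ⇒≤ m n (subst T (sym eq) _)) (<⇒≱ n<m)

≢-pair⇒≡ᵇ-false : ∀ {a b c d} → ¬ (a ≡ c × b ≡ d) → ((a ≡ᵇ c) ∧ (b ≡ᵇ d)) ≡ false
≢-pair⇒≡ᵇ-false {a} {b} {c} {d} ≢pair with a ≟ c
... | no a≢c rewrite ≢⇒≡ᵇ-false a≢c = refl
... | yes refl rewrite ≡ᵇ-refl a with b ≟ d
...   | no b≢d rewrite ≢⇒≡ᵇ-false b≢d = refl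
...   | yes refl = contradiction (refl , refl) ≢pair

outside⇒∈ᵇ-false : ∀ i M p q → p < i ⊎ i + M < q →
  (((i ≤ᵇ p) ∧ (p ≤ᵇ i + M)) ∧ ((i ≤ᵇ q) ∧ (q ≤ᵇ i + M))) ≡ false
outside⇒∈ᵇ-false i M p q (inj₁ p<i) rewrite >⇒≤ᵇ-false p<i = refl
outside⇒∈ᵇ-false i M p q (inj₂ i+M<q) rewrite >⇒≤ᵇ-false i+M<q =
  trans (cong (((i ≤ᵇ p) ∧ (p ≤ᵇ i + M)) ∧_) (∧-zeroʳ (i ≤ᵇ q))) (∧-zeroʳ _)

-- In C ∘ᵢ D with size D = suc k, a vertex v of C beyond i becomes v + k.

+suc<+⇒suc< : ∀ {i k v} → i + suc k < v + k → suc i < v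
+suc<+⇒suc< {i} {k} {v} h = +-cancelʳ-< k (suc i) v (subst (_< v + k) (+-suc i k) h)

suc<⇒+suc<+ : ∀ {i k v} → suc i < v → i + suc k < v + k
suc<⇒+suc<+ {i} {k} {v} h = subst (_< v + k) (sym (+-suc i k)) (+-monoˡ-< k h)

+suc≤+⇒< : ∀ {i k v} → i + suc k ≤ v + k → i < v
+suc≤+⇒< {i} {k} {v} h = +-cancelʳ-≤ k (suc i) v (subst (_≤ v + k) (+-suc i k) h)

<⇒+suc≤+ : ∀ {i k v} → i < v → i + suc k ≤ v + k
<⇒+suc≤+ {i} {k} {v} h = subst (_≤ v + k) (sym (+-suc i k)) (+-monoˡ-≤ k h)

beyond-span : ∀ {i k v} → i + suc k ≤ v → ∃ λ v' → v ≡ v' + k × i < v'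
beyond-span {i} {k} {v} h = v ∸ k , sym v∸k+k≡v , +suc≤+⇒< (subst (i + suc k ≤_) (sym v∸k+k≡v) h)
  where
  v∸k+k≡v : v ∸ k + k ≡ v
  v∸k+k≡v = m∸n+n≡m (≤-trans (m≤n+m k (suc i)) (≤-trans (≤-reflexive (sym (+-suc i k))) h))

above-span : ∀ {i k v} → i + suc k < v → ∃ λ v' → v ≡ v' + k × suc i < v'
above-span h with beyond-span (<⇒≤ h)
... | v' , refl , _ = v' , refl , +suc<+⇒suc< h

ArcsAgree : ℕ → Colouring → Colouring → Set
ArcsAgree N C D = ∀ p q → 1 ≤ p → p < q → q ≤ N → col C p q ≡ col D p q

over-span-outside : ∀ {i k p v} → p ≤ i → i < v → ¬ (p ≡ i × v ≡ suc i) → p < i ⊎ i + suc k < v + k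
over-span-outside {i} {k} {p} p≤i i<v notEdge with p ≟ i
... | no p≢i  = inj₁ (≤∧≢⇒< p≤i p≢i)
... | yes p≡i = inj₂ (suc<⇒+suc<+ (≤∧≢⇒< i<v (λ e → notEdge (p≡i , sym e))))

-- The arc (p,q) of C ∘ᵢ D with size D = suc k; inD x y is the arc (x+1,y+1) of D, and
-- arcs of C are given in C's own vertex numbering.
data Region (i k p q : ℕ) : Set where
  glued   : p ≡ i → q ≡ i + suc k → Region i k p q
  inD     : ∀ x y → p ≡ i + x → q ≡ i + y → x < y → y ≤ suc k → ¬ (x ≡ 0 × y ≡ suc k) →
            Region i k p q
  beforeD : p < q → q ≤ i → Region i k p q
  overD   : ∀ q' → q ≡ q' + k → p ≤ i → i < q' → ¬ (p ≡ i × q' ≡ suc i) → Region i k p q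
  afterD  : ∀ p' q' → p ≡ p' + k → q ≡ q' + k → i < p' → p' < q' → Region i k p q
  enterD  : p < i → i < q → q < i + suc k → Region i k p q
  leaveD  : i < p → p < i + suc k → i + suc k < q → Region i k p q

regionColour : ∀ {i k p q} → Colouring → Colouring → Region i k p q → Colour
regionColour {i} {k} C D (glued _ _)           = glue (col C i (suc i)) (col D 1 (suc (suc k)))
regionColour C D (inD x y _ _ _ _ _)           = col D (suc x) (suc y)
regionColour {p = p} {q} C D (beforeD _ _)     = col C p q
regionColour {p = p} C D (overD q' _ _ _ _)    = col C p q'
regionColour C D (afterD p' q' _ _ _ _)        = col C p' q'
regionColour C D (enterD _ _ _)                = uncol
regionColour C D (leaveD _ _ _)                = uncol

compose-col : ∀ C i D k → size D ≡ suc k → ∀ {p q} (r : Region i k p q) →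
  col (compose C i D) p q ≡ regionColour C D r
compose-col C i (mkCol _ _) k refl (glued refl refl)
  rewrite ≡ᵇ-refl i | ≡ᵇ-refl (i + suc k) = refl
compose-col C i (mkCol _ _) k refl (inD x y refl refl x<y y≤ notBase)
  rewrite ≢-pair⇒≡ᵇ-false {i + x} {i + y} {i} {i + suc k}
            (λ (e₁ , e₂) → notBase (+-cancelˡ-≡ i x 0 (trans e₁ (sym (+-identityʳ i))) ,
                                    +-cancelˡ-≡ i y (suc k) e₂))
        | ≤⇒≤ᵇ-true (m≤m+n i x) | ≤⇒≤ᵇ-true (+-monoʳ-≤ i (<⇒≤ (<-≤-trans x<y y≤)))
        | ≤⇒≤ᵇ-true (m≤m+n i y) | ≤⇒≤ᵇ-true (+-monoʳ-≤ i y≤)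
        | m+n∸m≡n i x | m+n∸m≡n i y = refl
compose-col C i (mkCol _ _) k refl {p} {q} (beforeD p<q q≤i)
  rewrite ≢⇒≡ᵇ-false (<⇒≢ (<-≤-trans p<q q≤i))
        | >⇒≤ᵇ-false {i} {p} (<-≤-trans p<q q≤i)
        | ≤⇒≤ᵇ-true (<⇒≤ (<-≤-trans p<q q≤i)) | ≤⇒≤ᵇ-true q≤i = refl
compose-col C i (mkCol _ _) k refl {p} (overD q' refl p≤i i<q' notEdge)
  rewrite ≢-pair⇒≡ᵇ-false {p} {q' + k} {i} {i + suc k}
            (λ (e₁ , e₂) → notEdge (e₁ , +-cancelʳ-≡ k q' (suc i) (trans e₂ (+-suc i k))))
        | outside⇒∈ᵇ-false i (suc k) p (q' + k) (over-span-outside p≤i i<q' notEdge)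
        | ≤⇒≤ᵇ-true p≤i | >⇒≤ᵇ-false {q' + k} {i} (m≤n⇒m≤n+o k i<q')
        | ≤⇒≤ᵇ-true (<⇒+suc≤+ {i} {k} i<q') | m+n∸n≡m q' k = refl
compose-col C i (mkCol _ _) k refl (afterD p' q' refl refl i<p' p'<q')
  rewrite ≢⇒≡ᵇ-false (≢-sym (<⇒≢ (m≤n⇒m≤n+o k i<p')))
        | outside⇒∈ᵇ-false i (suc k) (p' + k) (q' + k) (inj₂ (suc<⇒+suc<+ (≤-<-trans i<p' p'<q')))
        | >⇒≤ᵇ-false {p' + k} {i} (m≤n⇒m≤n+o k i<p') | ≤⇒≤ᵇ-true (<⇒+suc≤+ {i} {k} i<p')
        | >⇒≤ᵇ-false {q' + k} {i} (m≤n⇒m≤n+o k (<-trans i<p' p'<q'))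
        | ≤⇒≤ᵇ-true (<⇒+suc≤+ {i} {k} (<-trans i<p' p'<q'))
        | m+n∸n≡m q' k | m+n∸n≡m p' k = refl
compose-col C i (mkCol _ _) k refl {p} {q} (enterD p<i i<q q<span)
  rewrite ≢⇒≡ᵇ-false (<⇒≢ p<i)
        | outside⇒∈ᵇ-false i (suc k) p q (inj₁ p<i)
        | ≤⇒≤ᵇ-true (<⇒≤ p<i) | >⇒≤ᵇ-false {q} {i} i<q
        | >⇒≤ᵇ-false {i + suc k} {q} q<span = refl
compose-col C i (mkCol _ _) k refl {p} {q} (leaveD i<p p<span span<q)
  rewrite ≢⇒≡ᵇ-false (≢-sym (<⇒≢ i<p))
        | outside⇒∈ᵇ-false i (suc k) p q (inj₂ span<q)
        | >⇒≤ᵇ-false {p} {i} i<p | >⇒≤ᵇ-false {i + suc k} {p} p<span = refl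

inD-region : ∀ i k {p q} → p < q → i ≤ p → q ≤ i + suc k → ¬ (p ≡ i × q ≡ i + suc k) →
  Region i k p q
inD-region i k p<q i≤p q≤span notGlued
  with m≤n⇒∃[o]m+o≡n i≤p | m≤n⇒∃[o]m+o≡n (≤-trans i≤p (<⇒≤ p<q))
... | x , refl | y , refl =
  inD x y refl refl (+-cancelˡ-< i x y p<q) (+-cancelˡ-≤ i y (suc k) q≤span)
      (λ (x≡0 , y≡k) → notGlued (trans (cong (i +_) x≡0) (+-identityʳ i) , cong (i +_) y≡k))

region : ∀ i k p q → p < q → Region i k p q
region i k p q p<q with q ≤? i
... | yes q≤i = beforeD p<q q≤i
... | no q≰i with i + suc k <? q
...   | yes span<q with above-span span<q
...     | q' , refl , si<q' with p ≤? i
...       | yes p≤i = overD q' refl p≤i (<-trans (n<1+n i) si<q') (λ (_ , e) → <⇒≢ si<q' (sym e))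
...       | no p≰i with p <? i + suc k
...         | yes p<span = leaveD (≰⇒> p≰i) p<span span<q
...         | no p≮span with beyond-span (≮⇒≥ p≮span)
...           | p' , refl , i<p' = afterD p' q' refl refl i<p' (+-cancelʳ-< k p' q' p<q)
region i k p q p<q | no q≰i | no span≮q with p <? i | q ≟ i + suc k
... | yes p<i | yes q≡span =
  overD (suc i) (trans q≡span (+-suc i k)) (<⇒≤ p<i) (n<1+n i) (λ (e , _) → <⇒≢ p<i e)
... | yes p<i | no q≢span = enterD p<i (≰⇒> q≰i) (≤∧≢⇒< (≮⇒≥ span≮q) q≢span)
... | no p≮i | _ with (p ≟ i) ×-dec (q ≟ i + suc k)
...   | yes (p≡i , q≡span) = glued p≡i q≡span
...   | no notGlued = inD-region i k p<q (≮⇒≥ p≮i) (≮⇒≥ span≮q) notGlued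

region-shift : ∀ o {i k p q} → Region i k p q → Region (o + i) k (o + p) (o + q)
region-shift o {i} {k} (glued refl refl) = glued refl (sym (+-assoc o i (suc k)))
region-shift o {i} (inD x y refl refl x<y y≤ notBase) =
  inD x y (sym (+-assoc o i x)) (sym (+-assoc o i y)) x<y y≤ notBase
region-shift o (beforeD p<q q≤i) = beforeD (+-monoʳ-< o p<q) (+-monoʳ-≤ o q≤i)
region-shift o {i} {k} {p} (overD q' refl p≤i i<q' notEdge) =
  overD (o + q') (sym (+-assoc o q' k)) (+-monoʳ-≤ o p≤i) (+-monoʳ-< o i<q')
    (λ (e₁ , e₂) → notEdge (+-cancelˡ-≡ o p i e₁ ,
                            +-cancelˡ-≡ o q' (suc i) (trans e₂ (sym (+-suc o i)))))
region-shift o {k = k} (afterD p' q' refl refl i<p' p'<q') =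
  afterD (o + p') (o + q') (sym (+-assoc o p' k)) (sym (+-assoc o q' k)) (+-monoʳ-< o i<p') (+-monoʳ-< o p'<q')
region-shift o {i} {k} {q = q} (enterD p<i i<q q<span) =
  enterD (+-monoʳ-< o p<i) (+-monoʳ-< o i<q) (subst (o + q <_) (sym (+-assoc o i (suc k))) (+-monoʳ-< o q<span))
region-shift o {i} {k} {p} {q} (leaveD i<p p<span span<q) =
  leaveD (+-monoʳ-< o i<p) (subst (o + p <_) (sym (+-assoc o i (suc k))) (+-monoʳ-< o p<span))
    (subst (_< o + q) (sym (+-assoc o i (suc k))) (+-monoʳ-< o span<q))

IsBase : Bool → ℕ → ℕ → ℕ → Set
IsBase skipBase N x y = T skipBase × x ≡ 1 × y ≡ N

-- When skipBase holds, C may differ from C' on the base arc (1,N) of C': in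
-- π (node g l r) the base of π l is recoloured by the first edge of πgen g.
compose-shift-cong : ∀ (C C' D D' : Colouring) o i k N skipBase →
  size D ≡ suc k → size D' ≡ suc k → 1 ≤ i → i < N →
  (∀ x y → 1 ≤ x → x < y → y ≤ N → ¬ IsBase skipBase N x y → col C (o + x) (o + y) ≡ col C' x y) →
  ArcsAgree (suc (suc k)) D D' →
  ∀ p q → 1 ≤ p → p < q → q ≤ N + k → ¬ IsBase skipBase (N + k) p q →
  col (compose C (o + i) D) (o + p) (o + q) ≡ col (compose C' i D') p q
compose-shift-cong C C' D D' o i k N skipBase size-D size-D' 1≤i i<N agreeC agreeD p q 1≤p p<q q≤ notBase =
  begin
    col (compose C (o + i) D) (o + p) (o + q)  ≡⟨ compose-col C (o + i) D k size-D (region-shift o r) ⟩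
    regionColour C D (region-shift o r)        ≡⟨ agree r ⟩
    regionColour C' D' r                       ≡⟨ compose-col C' i D' k size-D' r ⟨
    col (compose C' i D') p q                  ∎
  where
  open ≡-Reasoning
  r : Region i k p q
  r = region i k p q p<q
  agree : (r : Region i k p q) → regionColour C D (region-shift o r) ≡ regionColour C' D' r
  agree (glued refl refl) =
    cong₂ glue
      (trans (cong (col C (o + i)) (sym (+-suc o i)))
             (agreeC i (suc i) 1≤i (n<1+n i) i<N
                 (λ (b , i≡1 , si≡N) → notBase (b , i≡1 , trans (+-suc i k) (cong (_+ k) si≡N)))))
      (agreeD 1 (suc (suc k)) ≤-refl (s≤s (s≤s z≤n)) ≤-refl)
  agree (inD x y refl refl x<y y≤ _) = agreeD (suc x) (suc y) (s≤s z≤n) (s≤s x<y) (s≤s y≤)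
  agree (beforeD _ q≤i) =
    agreeC p q 1≤p p<q (≤-trans q≤i (<⇒≤ i<N)) (λ (_ , _ , q≡N) → <⇒≢ (≤-<-trans q≤i i<N) q≡N)
  agree (overD q' refl p≤i i<q' _) =
    agreeC p q' 1≤p (≤-<-trans p≤i i<q') (+-cancelʳ-≤ k q' N q≤)
      (λ (b , p≡1 , q'≡N) → notBase (b , p≡1 , cong (_+ k) q'≡N))
  agree (afterD p' q' refl refl i<p' p'<q') =
    agreeC p' q' (≤-trans 1≤i (<⇒≤ i<p')) p'<q' (+-cancelʳ-≤ k q' N q≤)
      (λ (_ , p'≡1 , _) → <⇒≢ (≤-<-trans 1≤i i<p') (sym p'≡1))
  agree (enterD _ _ _) = refl
  agree (leaveD _ _ _) = refl

-- Colours of π (node g l r)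

arity-pos : ∀ t → 1 ≤ arity t
arity-pos leaf         = ≤-refl
arity-pos (node _ l r) = ≤-trans (arity-pos l) (m≤m+n (arity l) (arity r))

≥1⇒≡suc : ∀ {n} → 1 ≤ n → ∃ λ k → n ≡ suc k
≥1⇒≡suc {suc n} _ = n , refl

size-π : ∀ t → size (π t) ≡ arity t
size-π leaf = refl
size-π (node α l r) rewrite size-π l | size-π r = +-comm (arity r) (arity l)
size-π (node β l r) rewrite size-π l | size-π r = +-comm (arity r) (arity l)

size-π-suc : ∀ t {k} → arity t ≡ suc k → size (π t) ≡ suc k
size-π-suc t = trans (size-π t)

firstEdge : Gen₂ → Colour
firstEdge α = blue
firstEdge β = uncol

πgen-firstEdge : ∀ g → col (πgen g) 1 2 ≡ firstEdge g
πgen-firstEdge α = refl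
πgen-firstEdge β = refl

πgen-base : ∀ g → col (πgen g) 1 3 ≡ blue
πgen-base α = refl
πgen-base β = refl

πgen-secondEdge : ∀ g → col (πgen g) 2 3 ≡ uncol
πgen-secondEdge α = refl
πgen-secondEdge β = refl

glue-firstEdge-blue : ∀ g → glue (firstEdge g) blue ≡ firstEdge g
glue-firstEdge-blue α = refl
glue-firstEdge-blue β = refl

firstEdge-blue⇒α : ∀ {g} → firstEdge g ≡ blue → g ≡ α
firstEdge-blue⇒α {α} _ = refl

-- With arity l = suc a and arity r = suc b, the top vertex of π (node g l r) is
-- vertex 3 + b of πgen g ∘₂ π r, shifted by a.
top-vertex : ∀ a b → suc (suc a + suc b) ≡ suc (suc (suc b)) + a
top-vertex a b = cong (λ n → suc (suc n)) (trans (+-suc a b) (cong suc (+-comm a b)))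

π-rootBase : ∀ g l r → col (π (node g l r)) 1 (suc (arity l + arity r)) ≡ blue
π-rootBase g l r with ≥1⇒≡suc (arity-pos l) | ≥1⇒≡suc (arity-pos r)
... | a , al | b , bl rewrite al | bl = begin
  col (π (node g l r)) 1 (suc (suc a + suc b))
    ≡⟨ compose-col (compose (πgen g) 2 (π r)) 1 (π l) a (size-π-suc l al)
         (overD (3 + b) (top-vertex a b) ≤-refl (s≤s (s≤s z≤n)) λ { (_ , ()) }) ⟩
  col (compose (πgen g) 2 (π r)) 1 (3 + b)
    ≡⟨ compose-col (πgen g) 2 (π r) b (size-π-suc r bl) (overD 3 refl (s≤s z≤n) ≤-refl λ { (() , _) }) ⟩
  col (πgen g) 1 3
    ≡⟨ πgen-base g ⟩
  blue ∎
  where open ≡-Reasoning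

π-base : ∀ t → col (π t) 1 (suc (arity t)) ≡ blue
π-base leaf         = refl
π-base (node g l r) = π-rootBase g l r

π-base-suc : ∀ t {k} → arity t ≡ suc k → col (π t) 1 (suc (suc k)) ≡ blue
π-base-suc t t-arity = subst (λ n → col (π t) 1 (suc n) ≡ blue) t-arity (π-base t)

π-leftBase : ∀ g l r → col (π (node g l r)) 1 (suc (arity l)) ≡ firstEdge g
π-leftBase g l r with ≥1⇒≡suc (arity-pos l) | ≥1⇒≡suc (arity-pos r)
... | a , al | b , bl rewrite al = begin
  col (π (node g l r)) 1 (suc (suc a))
    ≡⟨ compose-col (compose (πgen g) 2 (π r)) 1 (π l) a (size-π-suc l al) (glued refl refl) ⟩
  glue (col (compose (πgen g) 2 (π r)) 1 2) (col (π l) 1 (suc (suc a)))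
    ≡⟨ cong₂ glue (compose-col (πgen g) 2 (π r) b (size-π-suc r bl) (beforeD ≤-refl ≤-refl))
                  (π-base-suc l al) ⟩
  glue (col (πgen g) 1 2) blue
    ≡⟨ cong (λ c → glue c blue) (πgen-firstEdge g) ⟩
  glue (firstEdge g) blue
    ≡⟨ glue-firstEdge-blue g ⟩
  firstEdge g ∎
  where open ≡-Reasoning

π-inLeft : ∀ g l r p q → 1 ≤ p → p < q → q ≤ suc (arity l) → ¬ (p ≡ 1 × q ≡ suc (arity l)) →
  col (π (node g l r)) p q ≡ col (π l) p q
π-inLeft g l r (suc x) (suc y) _ (s≤s x<y) q≤ notBase with ≥1⇒≡suc (arity-pos l)
... | a , al rewrite al =
  compose-col (compose (πgen g) 2 (π r)) 1 (π l) a (size-π-suc l al)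
    (inD x y refl refl x<y (≤-pred q≤) (λ (x≡0 , y≡a) → notBase (cong suc x≡0 , cong suc y≡a)))

π-inRight : ∀ g l r p q → 1 ≤ p → p < q → q ≤ suc (arity r) → ¬ (p ≡ 1 × q ≡ suc (arity r)) →
  col (π (node g l r)) (arity l + p) (arity l + q) ≡ col (π r) p q
π-inRight g l r (suc x) (suc y) _ (s≤s x<y) q≤ notBase
  with ≥1⇒≡suc (arity-pos l) | ≥1⇒≡suc (arity-pos r)
... | a , al | b , bl rewrite al | bl =
  trans (compose-col (compose (πgen g) 2 (π r)) 1 (π l) a (size-π-suc l al)
           (afterD (2 + x) (2 + y) (cong suc (+-comm a (suc x))) (cong suc (+-comm a (suc y)))
                   (s≤s (s≤s z≤n)) (s≤s (s≤s x<y))))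
        (compose-col (πgen g) 2 (π r) b (size-π-suc r bl)
           (inD x y refl refl x<y (≤-pred q≤) (λ (x≡0 , y≡b) → notBase (cong suc x≡0 , cong suc y≡b))))

π-crossing : ∀ g l r p q → 1 ≤ p → p < suc (arity l) → suc (arity l) < q →
  q ≤ suc (arity l + arity r) →
  ¬ (p ≡ 1 × q ≡ suc (arity l + arity r)) → col (π (node g l r)) p q ≡ uncol
π-crossing g l r 1 q _ _ a<q q≤ notRoot with ≥1⇒≡suc (arity-pos l) | ≥1⇒≡suc (arity-pos r)
... | a , al | b , bl rewrite al | bl with above-span {1} {a} a<q
...   | q' , refl , 2<q' =
  trans (compose-col (compose (πgen g) 2 (π r)) 1 (π l) a (size-π-suc l al)
           (overD q' refl ≤-refl (<-trans (s≤s (s≤s z≤n)) 2<q')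
                  (λ (_ , q'≡2) → <⇒≢ 2<q' (sym q'≡2))))
        (compose-col (πgen g) 2 (π r) b (size-π-suc r bl) (enterD ≤-refl 2<q' q'<top))
  where
  q'<top : q' < 3 + b
  q'<top = +-cancelʳ-< a q' (3 + b)
             (subst (q' + a <_) (top-vertex a b) (≤∧≢⇒< q≤ (λ q≡top → notRoot (refl , q≡top))))
π-crossing g l r (suc (suc p)) q _ p<a a<q _ _ with ≥1⇒≡suc (arity-pos l)
... | a , al rewrite al =
  compose-col (compose (πgen g) 2 (π r)) 1 (π l) a (size-π-suc l al) (leaveD (s≤s (s≤s z≤n)) p<a a<q)

π-rightBase : ∀ g l r → col (π (node g l r)) (suc (arity l)) (suc (arity l + arity r)) ≡ uncol
π-rightBase g l r with ≥1⇒≡suc (arity-pos l) | ≥1⇒≡suc (arity-pos r)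
... | a , al | b , bl rewrite al | bl = begin
  col (π (node g l r)) (suc (suc a)) (suc (suc a + suc b))
    ≡⟨ compose-col (compose (πgen g) 2 (π r)) 1 (π l) a (size-π-suc l al)
         (afterD 2 (3 + b) refl (top-vertex a b) ≤-refl (s≤s (s≤s (s≤s z≤n)))) ⟩
  col (compose (πgen g) 2 (π r)) 2 (3 + b)
    ≡⟨ compose-col (πgen g) 2 (π r) b (size-π-suc r bl) (glued refl refl) ⟩
  glue (col (πgen g) 2 3) (col (π r) 1 (2 + b))
    ≡⟨ cong₂ glue (πgen-secondEdge g) (π-base-suc r bl) ⟩
  uncol ∎
  where open ≡-Reasoning

-- π commutes with grafting

data NodeArc (a b p q : ℕ) : Set where
  rootBase  : p ≡ 1 → q ≡ suc (a + b) → NodeArc a b p q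
  leftBase  : p ≡ 1 → q ≡ suc a → NodeArc a b p q
  inLeft    : q ≤ suc a → ¬ (p ≡ 1 × q ≡ suc a) → NodeArc a b p q
  inRight   : ∀ p' q' → p ≡ a + p' → q ≡ a + q' → 1 ≤ p' → p' < q' → q' ≤ suc b →
              ¬ (p' ≡ 1 × q' ≡ suc b) → NodeArc a b p q
  crossing  : p < suc a → suc a < q → ¬ (p ≡ 1 × q ≡ suc (a + b)) → NodeArc a b p q
  rightBase : p ≡ suc a → q ≡ suc (a + b) → NodeArc a b p q

nodeArc : ∀ a b p q → p < q → q ≤ suc (a + b) → NodeArc a b p q
nodeArc a b p q p<q q≤ with q ≤? suc a
... | yes q≤a with (p ≟ 1) ×-dec (q ≟ suc a)
...   | yes (p≡1 , q≡a) = leftBase p≡1 q≡a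
...   | no notBase      = inLeft q≤a notBase
nodeArc a b p q p<q q≤ | no q≰a with p ≤? a
...   | yes p≤a with (p ≟ 1) ×-dec (q ≟ suc (a + b))
...     | yes (p≡1 , q≡top) = rootBase p≡1 q≡top
...     | no notRoot        = crossing (s≤s p≤a) (≰⇒> q≰a) notRoot
nodeArc a b p q p<q q≤ | no q≰a | no p≰a with (p ≟ suc a) ×-dec (q ≟ suc (a + b))
...     | yes (p≡a , q≡top) = rightBase p≡a q≡top
...     | no notBase
        with m≤n⇒∃[o]m+o≡n (<⇒≤ (≰⇒> p≰a))
           | m≤n⇒∃[o]m+o≡n (<⇒≤ (<-trans (≰⇒> p≰a) p<q))
...       | p' , refl | q' , refl =
  inRight p' q' refl refl (+-cancelˡ-< a 0 p' (subst (_< a + p') (sym (+-identityʳ a)) (≰⇒> p≰a)))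
    (+-cancelˡ-< a p' q' p<q) (+-cancelˡ-≤ a q' (suc b) (subst (a + q' ≤_) (sym (+-suc a b)) q≤))
    (λ (p'≡1 , q'≡b) → notBase (trans (cong (a +_) p'≡1) (+-comm a 1) ,
                                trans (cong (a +_) q'≡b) (+-suc a b)))

graft-node-left : ∀ g l r t {i} → i ≤ arity l → graft (node g l r) i t ≡ node g (graft l i t) r
graft-node-left g l r t i≤a rewrite ≤⇒≤ᵇ-true i≤a = refl

graft-node-right : ∀ g l r t {i} → arity l < i → graft (node g l r) i t ≡ node g l (graft r (i ∸ arity l) t)
graft-node-right g l r t a<i rewrite >⇒≤ᵇ-false a<i = refl

∸-within : ∀ {a b i} → a < i → i ≤ a + b → 1 ≤ i ∸ a × i ∸ a ≤ b
∸-within {a} {b} {i} a<i i≤ =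
  +-cancelˡ-< a 0 (i ∸ a) (subst₂ _<_ (sym (+-identityʳ a)) (sym a+[i∸a]≡i) a<i) ,
  +-cancelˡ-≤ a (i ∸ a) b (subst (_≤ a + b) (sym a+[i∸a]≡i) i≤)
  where
  a+[i∸a]≡i : a + (i ∸ a) ≡ i
  a+[i∸a]≡i = m+[n∸m]≡n (<⇒≤ a<i)

arity-graft : ∀ s i t {k} → arity t ≡ suc k → arity (graft s i t) ≡ arity s + k
arity-graft leaf i t t-arity = t-arity
arity-graft (node g l r) i t {k} t-arity with i ≤? arity l
... | yes i≤a rewrite graft-node-left g l r t i≤a =
  trans (cong (_+ arity r) (arity-graft l i t t-arity)) (xy∙z≈xz∙y (arity l) k (arity r))
... | no i≰a rewrite graft-node-right g l r t (≰⇒> i≰a) =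
  trans (cong (arity l +_) (arity-graft r (i ∸ arity l) t t-arity)) (sym (+-assoc (arity l) (arity r) k))

compose-unitˡ-π : ∀ t {k} → arity t ≡ suc k → ArcsAgree (suc (suc k)) (π t) (compose unitC 1 (π t))
compose-unitˡ-π t {k} t-arity p q 1≤p p<q q≤ =
  sym (trans (compose-col unitC 1 (π t) k (size-π-suc t t-arity) reg) (unit-region reg))
  where
  reg = region 1 k p q p<q
  q'≤2 : ∀ {q'} → q ≡ q' + k → q' ≤ 2
  q'≤2 {q'} q≡q'+k = +-cancelʳ-≤ k q' 2 (subst (_≤ suc (suc k)) q≡q'+k q≤)
  unit-region : (reg : Region 1 k p q) → regionColour unitC (π t) reg ≡ col (π t) p q
  unit-region (glued refl refl)          = trans (cong (glue blue) base) (sym base)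
    where base = π-base-suc t t-arity
  unit-region (inD x y refl refl _ _ _)  = refl
  unit-region (beforeD p<q' q≤1)         = contradiction q≤1 (<⇒≱ (≤-<-trans 1≤p p<q'))
  unit-region (overD q' q≡ p≤1 1<q' notEdge) =
    contradiction (≤-antisym p≤1 1≤p , ≤-antisym (q'≤2 q≡) 1<q') notEdge
  unit-region (afterD p' q' _ q≡ 1<p' p'<q') = contradiction (<-≤-trans p'<q' (q'≤2 q≡)) (<⇒≱ (s≤s 1<p'))
  unit-region (enterD p<1 _ _)           = contradiction 1≤p (<⇒≱ p<1)
  unit-region (leaveD _ _ span<q)        = contradiction q≤ (<⇒≱ span<q)

module GraftIntoLeft (g : Gen₂) (l r t : Tree) {i k : ℕ} (t-arity : arity t ≡ suc k)
                     (1≤i : 1 ≤ i) (i≤a : i ≤ arity l)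
                     (IH : ArcsAgree (suc (arity l + k)) (π (graft l i t)) (compose (π l) i (π t))) where
  private
    a b : ℕ
    a = arity l
    b = arity r
    l' s : Tree
    l' = graft l i t
    s  = node g l r
    a' : ℕ
    a' = arity l'
    a'≡a+k : a' ≡ a + k
    a'≡a+k = arity-graft l i t t-arity
    top : suc (a' + b) ≡ suc (a + b) + k
    top = cong suc (trans (cong (_+ b) a'≡a+k) (xy∙z≈xz∙y a k b))
    i<a+b : i < a + b
    i<a+b = ≤-<-trans i≤a (m<m+n a (arity-pos r))
    size-t : size (π t) ≡ suc k
    size-t = size-π-suc t t-arity
    composed : ∀ {p q} (reg : Region i k p q) → col (compose (π s) i (π t)) p q ≡ regionColour (π s) (π t) reg
    composed = compose-col (π s) i (π t) k size-t

  rootBase-agrees : col (π (node g l' r)) 1 (suc (a' + b)) ≡ col (compose (π s) i (π t)) 1 (suc (a' + b))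
  rootBase-agrees =
    trans (trans (π-rootBase g l' r) (sym (π-rootBase g l r)))
      (sym (composed (overD (suc (a + b)) top 1≤i (s≤s (<⇒≤ i<a+b))
                            (λ (_ , e) → <⇒≢ i<a+b (sym (suc-injective e))))))

  leftBase-agrees : col (π (node g l' r)) 1 (suc a') ≡ col (compose (π s) i (π t)) 1 (suc a')
  leftBase-agrees with (i ≟ 1) ×-dec (a ≟ 1)
  ... | yes (i≡1 , a≡1) =
    trans (π-leftBase g l' r)
      (sym (trans (composed (glued (sym i≡1) q≡span))
                  (trans (cong₂ glue edge (π-base-suc t t-arity)) (glue-firstEdge-blue g))))
    where
    q≡span : suc a' ≡ i + suc k
    q≡span = trans (cong suc a'≡a+k) (trans (cong (λ n → suc (n + k)) a≡1) (cong (_+ suc k) (sym i≡1)))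
    edge : col (π s) i (suc i) ≡ firstEdge g
    edge = trans (cong₂ (col (π s)) i≡1 (cong suc (trans i≡1 (sym a≡1)))) (π-leftBase g l r)
  ... | no ¬i≡a≡1 =
    trans (π-leftBase g l' r)
      (sym (trans (composed (overD (suc a) (cong suc a'≡a+k) 1≤i (s≤s i≤a)
                                   (λ (1≡i , a≡i) →
                                      ¬i≡a≡1 (sym 1≡i , trans (suc-injective a≡i) (sym 1≡i)))))
                  (π-leftBase g l r)))

  inLeft-agrees : ∀ p q → 1 ≤ p → p < q → q ≤ suc a' → ¬ (p ≡ 1 × q ≡ suc a') →
    col (π (node g l' r)) p q ≡ col (compose (π s) i (π t)) p q
  inLeft-agrees p q 1≤p p<q q≤a' notBase =
    trans (π-inLeft g l' r p q 1≤p p<q q≤a' notBase)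
      (trans (IH p q 1≤p p<q q≤)
        (sym (compose-shift-cong (π s) (π l) (π t) (π t) 0 i k (suc a) true size-t size-t 1≤i (s≤s i≤a)
               (λ x y 1≤x x<y y≤ notB →
                  π-inLeft g l r x y 1≤x x<y y≤ (λ (x≡1 , y≡a) → notB (_ , x≡1 , y≡a)))
               (λ _ _ _ _ _ → refl) p q 1≤p p<q q≤
               (λ (_ , p≡1 , q≡) → notBase (p≡1 , trans q≡ (cong suc (sym a'≡a+k)))))))
    where
    q≤ : q ≤ suc (a + k)
    q≤ = ≤-trans q≤a' (≤-reflexive (cong suc a'≡a+k))

  inRight-agrees : ∀ p q → 1 ≤ p → p < q → q ≤ suc b → ¬ (p ≡ 1 × q ≡ suc b) →
    col (π (node g l' r)) (a' + p) (a' + q) ≡ col (compose (π s) i (π t)) (a' + p) (a' + q)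
  inRight-agrees p q 1≤p p<q q≤ notBase =
    trans (trans (π-inRight g l' r p q 1≤p p<q q≤ notBase) (sym (π-inRight g l r p q 1≤p p<q q≤ notBase)))
      (sym (composed (afterD (a + p) (a + q) (shifted p) (shifted q) (≤-<-trans i≤a (m<m+n a 1≤p))
                             (+-monoʳ-< a p<q))))
    where
    shifted : ∀ v → a' + v ≡ a + v + k
    shifted v = trans (cong (_+ v) a'≡a+k) (xy∙z≈xz∙y a k v)

  crossing-uncol : ∀ p q → 1 ≤ p → p < suc a' → suc a' < q → q ≤ suc (a' + b) →
    ¬ (p ≡ 1 × q ≡ suc (a' + b)) → col (compose (π s) i (π t)) p q ≡ uncol
  crossing-uncol p q 1≤p p<a' a'<q q≤ notRoot
    with above-span {a} {k} (subst (_< q) (trans (cong suc a'≡a+k) (sym (+-suc a k))) a'<q)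
  ... | q' , refl , a<q' = crossing-from (p ≤? i)
    where
    q'≤ : q' ≤ suc (a + b)
    q'≤ = +-cancelʳ-≤ k q' (suc (a + b)) (subst (q' + k ≤_) top q≤)
    notRoot' : ¬ (p ≡ 1 × q' ≡ suc (a + b))
    notRoot' (p≡1 , q'≡top) = notRoot (p≡1 , trans (cong (_+ k) q'≡top) (sym top))
    crossing-from : Dec (p ≤ i) → col (compose (π s) i (π t)) p (q' + k) ≡ uncol
    crossing-from (yes p≤i) =
      trans (composed (overD q' refl p≤i (≤-<-trans i≤a (<-trans (n<1+n a) a<q'))
                             (λ (_ , q'≡i) → <⇒≢ (≤-<-trans (s≤s i≤a) a<q') (sym q'≡i))))
            (π-crossing g l r p q' 1≤p (s≤s (≤-trans p≤i i≤a)) a<q' q'≤ notRoot')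
    crossing-from (no p≰i) with p <? i + suc k
    ... | yes p<span = composed (leaveD (≰⇒> p≰i) p<span (suc<⇒+suc<+ (≤-<-trans (s≤s i≤a) a<q')))
    ... | no p≮span with beyond-span (≮⇒≥ p≮span)
    ...   | p' , refl , i<p' =
      trans (composed (afterD p' q' refl refl i<p' (+-cancelʳ-< k p' q' p<q)))
            (π-crossing g l r p' q' (≤-trans 1≤i (<⇒≤ i<p'))
               (+-cancelʳ-< k p' (suc a) (subst (p' + k <_) (cong suc a'≡a+k) p<a'))
               a<q' q'≤ (λ (p'≡1 , _) → <⇒≢ (≤-<-trans 1≤i i<p') (sym p'≡1)))
      where
      p<q : p' + k < q' + k
      p<q = <-trans p<a' a'<q

  rightBase-agrees :
    col (π (node g l' r)) (suc a') (suc (a' + b)) ≡ col (compose (π s) i (π t)) (suc a') (suc (a' + b))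
  rightBase-agrees =
    trans (trans (π-rightBase g l' r) (sym (π-rightBase g l r)))
      (sym (composed (afterD (suc a) (suc (a + b)) (cong suc a'≡a+k) top (s≤s i≤a)
                             (s≤s (m<m+n a (arity-pos r))))))

  arcs-agree : ArcsAgree (suc (a + b + k)) (π (node g l' r)) (compose (π s) i (π t))
  arcs-agree p q 1≤p p<q q≤ = agrees (nodeArc a' b p q p<q q≤')
    where
    q≤' : q ≤ suc (a' + b)
    q≤' = ≤-trans q≤ (≤-reflexive (sym top))
    agrees : NodeArc a' b p q → col (π (node g l' r)) p q ≡ col (compose (π s) i (π t)) p q
    agrees (rootBase refl refl) = rootBase-agrees
    agrees (leftBase refl refl) = leftBase-agrees
    agrees (inLeft q≤a' notBase) = inLeft-agrees p q 1≤p p<q q≤a' notBase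
    agrees (inRight p' q' refl refl 1≤p' p'<q' q'≤ notBase) = inRight-agrees p' q' 1≤p' p'<q' q'≤ notBase
    agrees (crossing p<a' a'<q notRoot) =
      trans (π-crossing g l' r p q 1≤p p<a' a'<q q≤' notRoot)
            (sym (crossing-uncol p q 1≤p p<a' a'<q q≤' notRoot))
    agrees (rightBase refl refl) = rightBase-agrees

module GraftIntoRight (g : Gen₂) (l r t : Tree) {i k : ℕ} (t-arity : arity t ≡ suc k)
                      (a<i : arity l < i) (i≤a+b : i ≤ arity l + arity r)
                      (IH : ArcsAgree (suc (arity r + k)) (π (graft r (i ∸ arity l) t))
                                      (compose (π r) (i ∸ arity l) (π t))) where
  private
    a b j : ℕ
    a = arity l
    b = arity r
    j = i ∸ a
    r' s : Tree
    r' = graft r j t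
    s  = node g l r
    b' : ℕ
    b' = arity r'
    a+j≡i : a + j ≡ i
    a+j≡i = m+[n∸m]≡n (<⇒≤ a<i)
    b'≡b+k : b' ≡ b + k
    b'≡b+k = arity-graft r j t t-arity
    top : suc (a + b') ≡ suc (a + b) + k
    top = cong suc (trans (cong (a +_) b'≡b+k) (sym (+-assoc a b k)))
    1<i : 1 < i
    1<i = ≤-<-trans (arity-pos l) a<i
    size-t : size (π t) ≡ suc k
    size-t = size-π-suc t t-arity
    composed : ∀ {p q} (reg : Region i k p q) → col (compose (π s) i (π t)) p q ≡ regionColour (π s) (π t) reg
    composed = compose-col (π s) i (π t) k size-t

  rootBase-agrees : col (π (node g l r')) 1 (suc (a + b')) ≡ col (compose (π s) i (π t)) 1 (suc (a + b'))
  rootBase-agrees =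
    trans (trans (π-rootBase g l r') (sym (π-rootBase g l r)))
      (sym (composed (overD (suc (a + b)) top (<⇒≤ 1<i) (s≤s i≤a+b) (λ (1≡i , _) → <⇒≢ 1<i 1≡i))))

  leftBase-agrees : col (π (node g l r')) 1 (suc a) ≡ col (compose (π s) i (π t)) 1 (suc a)
  leftBase-agrees =
    trans (trans (π-leftBase g l r') (sym (π-leftBase g l r)))
      (sym (composed (beforeD (s≤s (arity-pos l)) a<i)))

  inLeft-agrees : ∀ p q → 1 ≤ p → p < q → q ≤ suc a → ¬ (p ≡ 1 × q ≡ suc a) →
    col (π (node g l r')) p q ≡ col (compose (π s) i (π t)) p q
  inLeft-agrees p q 1≤p p<q q≤a notBase =
    trans (trans (π-inLeft g l r' p q 1≤p p<q q≤a notBase) (sym (π-inLeft g l r p q 1≤p p<q q≤a notBase)))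
      (sym (composed (beforeD p<q (≤-trans q≤a a<i))))

  inRight-agrees : ∀ p q → 1 ≤ p → p < q → q ≤ suc b' → ¬ (p ≡ 1 × q ≡ suc b') →
    col (π (node g l r')) (a + p) (a + q) ≡ col (compose (π s) i (π t)) (a + p) (a + q)
  inRight-agrees p q 1≤p p<q q≤b' notBase = begin
    col (π (node g l r')) (a + p) (a + q)        ≡⟨ π-inRight g l r' p q 1≤p p<q q≤b' notBase ⟩
    col (π r') p q                               ≡⟨ IH p q 1≤p p<q q≤ ⟩
    col (compose (π r) j (π t)) p q              ≡⟨ shift-cong ⟨
    col (compose (π s) (a + j) (π t)) (a + p) (a + q)
      ≡⟨ cong (λ n → col (compose (π s) n (π t)) (a + p) (a + q)) a+j≡i ⟩
    col (compose (π s) i (π t)) (a + p) (a + q)  ∎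
    where
    open ≡-Reasoning
    q≤ : q ≤ suc (b + k)
    q≤ = ≤-trans q≤b' (≤-reflexive (cong suc b'≡b+k))
    shift-cong : col (compose (π s) (a + j) (π t)) (a + p) (a + q) ≡ col (compose (π r) j (π t)) p q
    shift-cong =
      compose-shift-cong (π s) (π r) (π t) (π t) a j k (suc b) true size-t size-t
        (proj₁ (∸-within a<i i≤a+b)) (s≤s (proj₂ (∸-within a<i i≤a+b)))
        (λ x y 1≤x x<y y≤ notB →
           π-inRight g l r x y 1≤x x<y y≤ (λ (x≡1 , y≡b) → notB (_ , x≡1 , y≡b)))
        (λ _ _ _ _ _ → refl) p q 1≤p p<q q≤
        (λ (_ , p≡1 , q≡) → notBase (p≡1 , trans q≡ (cong suc (sym b'≡b+k))))

  crossing-uncol : ∀ p q → 1 ≤ p → p < suc a → suc a < q → q ≤ suc (a + b') →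
    ¬ (p ≡ 1 × q ≡ suc (a + b')) → col (compose (π s) i (π t)) p q ≡ uncol
  crossing-uncol p q 1≤p p<a a<q q≤ notRoot with q ≤? i
  ... | yes q≤i =
    trans (composed (beforeD (<-trans p<a a<q) q≤i))
          (π-crossing g l r p q 1≤p p<a a<q (≤-trans q≤i (≤-trans i≤a+b (n≤1+n _)))
             (λ (_ , q≡top) → <⇒≢ (s≤s (≤-trans q≤i i≤a+b)) q≡top))
  ... | no q≰i with q <? i + suc k
  ...   | yes q<span = composed (enterD (<-≤-trans p<a a<i) (≰⇒> q≰i) q<span)
  ...   | no q≮span with beyond-span (≮⇒≥ q≮span)
  ...     | q' , refl , i<q' =
    trans (composed (overD q' refl (<⇒≤ p<i) i<q' (λ (p≡i , _) → <⇒≢ p<i p≡i)))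
          (π-crossing g l r p q' 1≤p p<a (≤-<-trans a<i i<q')
             (+-cancelʳ-≤ k q' (suc (a + b)) (subst (q' + k ≤_) top q≤))
             (λ (p≡1 , q'≡top) → notRoot (p≡1 , trans (cong (_+ k) q'≡top) (sym top))))
    where
    p<i : p < i
    p<i = <-≤-trans p<a a<i

  rightBase-agrees :
    col (π (node g l r')) (suc a) (suc (a + b')) ≡ col (compose (π s) i (π t)) (suc a) (suc (a + b'))
  rightBase-agrees with (suc a ≟ i) ×-dec (suc (a + b') ≟ i + suc k)
  ... | yes (a≡i , top≡span) =
    trans (π-rightBase g l r')
      (sym (trans (composed (glued a≡i top≡span)) (cong₂ glue edge (π-base-suc t t-arity))))
    where
    i≡a+b : suc i ≡ suc (a + b)
    i≡a+b = +-cancelʳ-≡ k (suc i) (suc (a + b)) (trans (sym (+-suc i k)) (trans (sym top≡span) top))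
    edge : col (π s) i (suc i) ≡ uncol
    edge = trans (cong₂ (col (π s)) (sym a≡i) i≡a+b) (π-rightBase g l r)
  ... | no notGlued =
    trans (trans (π-rightBase g l r') (sym (π-rightBase g l r)))
      (sym (composed (overD (suc (a + b)) top a<i (s≤s i≤a+b)
                            (λ (a≡i , top≡i) →
                               notGlued (a≡i , trans top (trans (cong (_+ k) top≡i) (sym (+-suc i k))))))))

  arcs-agree : ArcsAgree (suc (a + b + k)) (π (node g l r')) (compose (π s) i (π t))
  arcs-agree p q 1≤p p<q q≤ = agrees (nodeArc a b' p q p<q q≤')
    where
    q≤' : q ≤ suc (a + b')
    q≤' = ≤-trans q≤ (≤-reflexive (sym top))
    agrees : NodeArc a b' p q → col (π (node g l r')) p q ≡ col (compose (π s) i (π t)) p q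
    agrees (rootBase refl refl) = rootBase-agrees
    agrees (leftBase refl refl) = leftBase-agrees
    agrees (inLeft q≤a notBase) = inLeft-agrees p q 1≤p p<q q≤a notBase
    agrees (inRight p' q' refl refl 1≤p' p'<q' q'≤ notBase) = inRight-agrees p' q' 1≤p' p'<q' q'≤ notBase
    agrees (crossing p<a a<q notRoot) =
      trans (π-crossing g l r' p q 1≤p p<a a<q q≤' notRoot)
            (sym (crossing-uncol p q 1≤p p<a a<q q≤' notRoot))
    agrees (rightBase refl refl) = rightBase-agrees

π-graft-arcs : ∀ s i t {k} → arity t ≡ suc k → 1 ≤ i → i ≤ arity s →
  ArcsAgree (suc (arity s + k)) (π (graft s i t)) (compose (π s) i (π t))
π-graft-arcs leaf 1 t t-arity _ _ = compose-unitˡ-π t t-arity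
π-graft-arcs leaf (suc (suc _)) t _ _ (s≤s ())
π-graft-arcs (node g l r) i t t-arity 1≤i i≤ with i ≤? arity l
... | yes i≤a rewrite graft-node-left g l r t i≤a =
  GraftIntoLeft.arcs-agree g l r t t-arity 1≤i i≤a (π-graft-arcs l i t t-arity 1≤i i≤a)
... | no i≰a rewrite graft-node-right g l r t (≰⇒> i≰a) =
  GraftIntoRight.arcs-agree g l r t t-arity (≰⇒> i≰a) i≤
    (π-graft-arcs r (i ∸ arity l) t t-arity (proj₁ (∸-within (≰⇒> i≰a) i≤))
                                            (proj₂ (∸-within (≰⇒> i≰a) i≤)))

π-graft : ∀ s i t → 1 ≤ i → i ≤ arity s → π (graft s i t) ≐ compose (π s) i (π t)
π-graft s i t 1≤i i≤ with ≥1⇒≡suc (arity-pos t)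
... | k , t-arity =
  sizes , λ p q 1≤p p<q q≤ → π-graft-arcs s i t t-arity 1≤i i≤ p q 1≤p p<q (subst (q ≤_) vertices q≤)
  where
  sizes : size (π (graft s i t)) ≡ size (π s) + size (π t) ∸ 1
  sizes rewrite size-π (graft s i t) | size-π s | size-π t | t-arity | arity-graft s i t t-arity
              | +-suc (arity s) k = refl
  vertices : size (π (graft s i t)) + 1 ≡ suc (arity s + k)
  vertices rewrite size-π (graft s i t) | arity-graft s i t t-arity = +-comm (arity s + k) 1

-- π is an operad morphism onto ⟨τaab, τbab⟩

≐-refl : ∀ {C} → C ≐ C
≐-refl = refl , λ _ _ _ _ _ → refl

≐-sym : ∀ {C D} → C ≐ D → D ≐ C
≐-sym (sizes , arcs) =
  sym sizes , λ p q 1≤p p<q q≤ → sym (arcs p q 1≤p p<q (subst (λ n → q ≤ n + 1) (sym sizes) q≤))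

≐-trans : ∀ {C D E} → C ≐ D → D ≐ E → C ≐ E
≐-trans (sizes₁ , arcs₁) (sizes₂ , arcs₂) =
  trans sizes₁ sizes₂ ,
  λ p q 1≤p p<q q≤ →
    trans (arcs₁ p q 1≤p p<q q≤) (arcs₂ p q 1≤p p<q (subst (λ n → q ≤ n + 1) sizes₁ q≤))

compose-cong : ∀ {C C' D D'} i → C ≐ C' → D ≐ D' → 1 ≤ i → i ≤ size C → 1 ≤ size D →
  compose C i D ≐ compose C' i D'
compose-cong {C} {C'} {D} {D'} i (sizesC , arcsC) (sizesD , arcsD) 1≤i i≤ 1≤D with ≥1⇒≡suc 1≤D
... | k , size-D =
  cong₂ (λ m n → m + n ∸ 1) sizesC sizesD ,
  λ p q 1≤p p<q q≤ →
    compose-shift-cong C C' D D' 0 i k (suc (size C)) false size-D (trans (sym sizesD) size-D) 1≤i (s≤s i≤)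
      (λ x y 1≤x x<y y≤ _ → arcsC x y 1≤x x<y (subst (y ≤_) (+-comm 1 (size C)) y≤))
      (λ x y 1≤x x<y y≤ →
         arcsD x y 1≤x x<y (subst (y ≤_) (trans (+-comm 1 (suc k)) (cong (_+ 1) (sym size-D))) y≤))
      p q 1≤p p<q (subst (q ≤_) (vertices (size C)) (subst (λ n → q ≤ size C + n ∸ 1 + 1) size-D q≤))
      (λ ())
  where
  vertices : ∀ n → n + suc k ∸ 1 + 1 ≡ suc n + k
  vertices n rewrite +-suc n k = +-comm (n + k) 1

π-graft-cong : ∀ s t {C D} i → π s ≐ C → π t ≐ D → 1 ≤ i → i ≤ arity s →
  π (graft s i t) ≐ compose C i D
π-graft-cong s t i πs≐C πt≐D 1≤i i≤ =
  ≐-trans (π-graft s i t 1≤i i≤)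
    (compose-cong i πs≐C πt≐D 1≤i (subst (i ≤_) (sym (size-π s)) i≤)
                                  (subst (1 ≤_) (sym (size-π t)) (arity-pos t)))

triangle-arcs : ∀ C D → col C 1 2 ≡ col D 1 2 → col C 1 3 ≡ col D 1 3 → col C 2 3 ≡ col D 2 3 →
  ArcsAgree 3 C D
triangle-arcs _ _ e₁₂ e₁₃ e₂₃ 1 2 _ _ _ = e₁₂
triangle-arcs _ _ e₁₂ e₁₃ e₂₃ 1 3 _ _ _ = e₁₃
triangle-arcs _ _ e₁₂ e₁₃ e₂₃ 2 3 _ _ _ = e₂₃
triangle-arcs _ _ _ _ _ 0 _ () _ _
triangle-arcs _ _ _ _ _ 1 0 _ () _
triangle-arcs _ _ _ _ _ 1 1 _ (s≤s ()) _
triangle-arcs _ _ _ _ _ _ (suc (suc (suc (suc _)))) _ _ (s≤s (s≤s (s≤s ())))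
triangle-arcs _ _ _ _ _ (suc (suc _)) 0 _ () _
triangle-arcs _ _ _ _ _ (suc (suc _)) 1 _ (s≤s ()) _
triangle-arcs _ _ _ _ _ (suc (suc _)) 2 _ (s≤s (s≤s ())) _
triangle-arcs _ _ _ _ _ (suc (suc (suc _))) 3 _ (s≤s (s≤s (s≤s ()))) _

square-arcs : ∀ C D → col C 1 2 ≡ col D 1 2 → col C 1 3 ≡ col D 1 3 → col C 1 4 ≡ col D 1 4 →
  col C 2 3 ≡ col D 2 3 → col C 2 4 ≡ col D 2 4 → col C 3 4 ≡ col D 3 4 → ArcsAgree 4 C D
square-arcs _ _ e₁₂ _ _ _ _ _ 1 2 _ _ _ = e₁₂
square-arcs _ _ _ e₁₃ _ _ _ _ 1 3 _ _ _ = e₁₃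
square-arcs _ _ _ _ e₁₄ _ _ _ 1 4 _ _ _ = e₁₄
square-arcs _ _ _ _ _ e₂₃ _ _ 2 3 _ _ _ = e₂₃
square-arcs _ _ _ _ _ _ e₂₄ _ 2 4 _ _ _ = e₂₄
square-arcs _ _ _ _ _ _ _ e₃₄ 3 4 _ _ _ = e₃₄
square-arcs _ _ _ _ _ _ _ _ 0 _ () _ _
square-arcs _ _ _ _ _ _ _ _ _ 0 _ () _
square-arcs _ _ _ _ _ _ _ _ 1 1 _ (s≤s ()) _
square-arcs _ _ _ _ _ _ _ _ _ (suc (suc (suc (suc (suc _))))) _ _ (s≤s (s≤s (s≤s (s≤s ()))))
square-arcs _ _ _ _ _ _ _ _ (suc (suc _)) 1 _ (s≤s ()) _
square-arcs _ _ _ _ _ _ _ _ (suc (suc _)) 2 _ (s≤s (s≤s ())) _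
square-arcs _ _ _ _ _ _ _ _ (suc (suc (suc _))) 3 _ (s≤s (s≤s (s≤s ()))) _
square-arcs _ _ _ _ _ _ _ _ (suc (suc (suc (suc _)))) 4 _ (s≤s (s≤s (s≤s (s≤s ())))) _

π-rel₁ : π (graft (gen β) 1 (gen β)) ≐ π (graft (gen β) 2 (gen β))
π-rel₁ =
  refl , square-arcs (π (graft (gen β) 1 (gen β))) (π (graft (gen β) 2 (gen β))) refl refl refl refl refl refl

π-rel₂ : π (graft (gen β) 1 (gen α)) ≐ π (graft (gen α) 2 (gen β))
π-rel₂ =
  refl , square-arcs (π (graft (gen β) 1 (gen α))) (π (graft (gen α) 2 (gen β))) refl refl refl refl refl refl

π-≐⇒arity-≡ : ∀ s t → π s ≐ π t → arity s ≡ arity t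
π-≐⇒arity-≡ s t (sizes , _) = trans (sym (size-π s)) (trans sizes (size-π t))

π-≐⇒ArcsAgree : ∀ s t → π s ≐ π t → ArcsAgree (suc (arity s)) (π s) (π t)
π-≐⇒ArcsAgree s t (_ , arcs) p q 1≤p p<q q≤ =
  arcs p q 1≤p p<q (subst (q ≤_) (trans (+-comm 1 (arity s)) (cong (_+ 1) (sym (size-π s)))) q≤)

π-cong : ∀ {s t} → s ≈ t → π s ≐ π t
π-cong rel₁           = π-rel₁
π-cong rel₂           = π-rel₂
π-cong ≈-refl         = ≐-refl
π-cong (≈-sym s≈t)    = ≐-sym (π-cong s≈t)
π-cong (≈-trans s≈t t≈u) = ≐-trans (π-cong s≈t) (π-cong t≈u)
π-cong (≈-comp {s} {s'} {t} {t'} i s≈s' t≈t' 1≤i i≤) =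
  ≐-trans (π-graft-cong s t i (π-cong s≈s') (π-cong t≈t') 1≤i i≤)
          (≐-sym (π-graft s' i t' 1≤i (subst (i ≤_) (π-≐⇒arity-≡ s s' (π-cong s≈s')) i≤)))

π-inGen : ∀ t → InGen (π t)
π-inGen leaf         = g-unit
π-inGen (node α l r) = g-comp 1 (g-comp 2 g-aab (π-inGen r) (s≤s z≤n) ≤-refl) (π-inGen l) ≤-refl (s≤s z≤n)
π-inGen (node β l r) = g-comp 1 (g-comp 2 g-bab (π-inGen r) (s≤s z≤n) ≤-refl) (π-inGen l) ≤-refl (s≤s z≤n)

inGen⇒π-image : ∀ C → InGen C → ∃ λ t → π t ≐ C
inGen⇒π-image _ g-unit = leaf , ≐-refl
inGen⇒π-image _ g-aab  = gen α , refl , triangle-arcs (π (gen α)) τaab refl refl refl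
inGen⇒π-image _ g-bab  = gen β , refl , triangle-arcs (π (gen β)) τbab refl refl refl
inGen⇒π-image _ (g-comp {C} {D} i C-gen D-gen 1≤i i≤)
  with inGen⇒π-image C C-gen | inGen⇒π-image D D-gen
... | s , πs≐C | t , πt≐D =
  graft s i t ,
  π-graft-cong s t i πs≐C πt≐D 1≤i (subst (i ≤_) (trans (sym (proj₁ πs≐C)) (size-π s)) i≤)

-- Normal forms and faithfulness

data NF : Tree → Set where
  nf-leaf : NF leaf
  nf-β    : ∀ {x} → NF x → NF (node β leaf x)
  nf-α    : ∀ {x y} → NF x → NF y → NF (node α x y)

node-nf : Gen₂ → Tree → Tree → Tree
node-nf α l            r = node α l r
node-nf β leaf         r = node β leaf r
node-nf β (node β x y) r = node-nf β x (node-nf β y r)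
node-nf β (node α x y) r = node α x (node-nf β y r)

node-nf-NF : ∀ g {l r} → NF l → NF r → NF (node-nf g l r)
node-nf-NF α l-nf           r-nf = nf-α l-nf r-nf
node-nf-NF β nf-leaf        r-nf = nf-β r-nf
node-nf-NF β (nf-β y-nf)    r-nf = nf-β (node-nf-NF β y-nf r-nf)
node-nf-NF β (nf-α x-nf y-nf) r-nf = nf-α x-nf (node-nf-NF β y-nf r-nf)

nf : Tree → Tree
nf leaf         = leaf
nf (node g l r) = node-nf g (nf l) (nf r)

nf-NF : ∀ t → NF (nf t)
nf-NF leaf         = nf-leaf
nf-NF (node g l r) = node-nf-NF g (nf-NF l) (nf-NF r)

≈-node : ∀ g {l l' r r'} → l ≈ l' → r ≈ r' → node g l r ≈ node g l' r'
≈-node g l≈l' r≈r' =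
  ≈-comp 1 (≈-comp 2 (≈-refl {gen g}) r≈r' (s≤s z≤n) ≤-refl) l≈l' ≤-refl (s≤s z≤n)

≈-assoc-under-β : ∀ {g} → graft (gen β) 1 (gen g) ≈ graft (gen g) 2 (gen β) →
  ∀ x y z → node β (node g x y) z ≈ node g x (node β y z)
≈-assoc-under-β rel x y z =
  ≈-comp 1 (≈-comp 2 (≈-comp 3 rel (≈-refl {z}) (s≤s z≤n) ≤-refl)
                      (≈-refl {y}) (s≤s z≤n) (s≤s (s≤s z≤n)))
           (≈-refl {x}) (s≤s z≤n) (s≤s z≤n)

node-nf-≈ : ∀ g l r → node-nf g l r ≈ node g l r
node-nf-≈ α l r = ≈-refl
node-nf-≈ β leaf r = ≈-refl
node-nf-≈ β (node β x y) r =
  ≈-trans (node-nf-≈ β x (node-nf β y r))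
    (≈-trans (≈-node β ≈-refl (node-nf-≈ β y r)) (≈-sym (≈-assoc-under-β rel₁ x y r)))
node-nf-≈ β (node α x y) r =
  ≈-trans (≈-node α ≈-refl (node-nf-≈ β y r)) (≈-sym (≈-assoc-under-β rel₂ x y r))

nf-≈ : ∀ t → nf t ≈ t
nf-≈ leaf         = ≈-refl
nf-≈ (node g l r) = ≈-trans (node-nf-≈ g (nf l) (nf r)) (≈-node g (nf-≈ l) (nf-≈ r))

leaf-arity≢node-arity : ∀ g l r → arity leaf ≢ arity (node g l r)
leaf-arity≢node-arity _ l r = <⇒≢ (+-mono-≤ (arity-pos l) (arity-pos r))

π-base-≡ : ∀ t t' → arity t ≡ arity t' → col (π t) 1 (suc (arity t)) ≡ col (π t') 1 (suc (arity t))
π-base-≡ t t' t≡t' =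
  trans (π-base t) (sym (subst (λ n → col (π t') 1 (suc n) ≡ blue) (sym t≡t') (π-base t')))

ArcsAgree-left : ∀ g g' l r l' r' → arity l ≡ arity l' →
  ArcsAgree (suc (arity l + arity r)) (π (node g l r)) (π (node g' l' r')) →
  ArcsAgree (suc (arity l)) (π l) (π l')
ArcsAgree-left g g' l r l' r' l≡l' agree p q 1≤p p<q q≤ with (p ≟ 1) ×-dec (q ≟ suc (arity l))
... | yes (refl , refl) = π-base-≡ l l' l≡l'
... | no notBase =
  trans (sym (π-inLeft g l r p q 1≤p p<q q≤ notBase))
    (trans (agree p q 1≤p p<q (≤-trans q≤ (s≤s (m≤m+n (arity l) (arity r)))))
      (π-inLeft g' l' r' p q 1≤p p<q (subst (λ n → q ≤ suc n) l≡l' q≤)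
        (λ (p≡1 , q≡l') → notBase (p≡1 , trans q≡l' (cong suc (sym l≡l'))))))

ArcsAgree-right : ∀ g g' l r l' r' → arity l ≡ arity l' → arity r ≡ arity r' →
  ArcsAgree (suc (arity l + arity r)) (π (node g l r)) (π (node g' l' r')) →
  ArcsAgree (suc (arity r)) (π r) (π r')
ArcsAgree-right g g' l r l' r' l≡l' r≡r' agree p q 1≤p p<q q≤ with (p ≟ 1) ×-dec (q ≟ suc (arity r))
... | yes (refl , refl) = π-base-≡ r r' r≡r'
... | no notBase = begin
  col (π r) p q
    ≡⟨ π-inRight g l r p q 1≤p p<q q≤ notBase ⟨
  col (π (node g l r)) (arity l + p) (arity l + q)
    ≡⟨ agree (arity l + p) (arity l + q) (≤-trans 1≤p (m≤n+m p (arity l))) (+-monoʳ-< (arity l) p<q)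
             (subst (arity l + q ≤_) (+-suc (arity l) (arity r)) (+-monoʳ-≤ (arity l) q≤)) ⟩
  col (π (node g' l' r')) (arity l + p) (arity l + q)
    ≡⟨ cong₂ (col (π (node g' l' r'))) (cong (_+ p) l≡l') (cong (_+ q) l≡l') ⟩
  col (π (node g' l' r')) (arity l' + p) (arity l' + q)
    ≡⟨ π-inRight g' l' r' p q 1≤p p<q (subst (λ n → q ≤ suc n) r≡r' q≤)
         (λ (p≡1 , q≡r') → notBase (p≡1 , trans q≡r' (cong suc (sym r≡r')))) ⟩
  col (π r') p q ∎
  where open ≡-Reasoning

π-node-blueFromOne : ∀ g l r k → arity l ≤ k → k < arity l + arity r →
  col (π (node g l r)) 1 (suc k) ≡ blue → g ≡ α × k ≡ arity l
π-node-blueFromOne g l r k l≤k k<n isBlue with m≤n⇒m<n∨m≡n l≤k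
... | inj₁ l<k = contradiction (trans (sym uncoloured) isBlue) λ ()
  where
  uncoloured : col (π (node g l r)) 1 (suc k) ≡ uncol
  uncoloured = π-crossing g l r 1 (suc k) ≤-refl (s≤s (arity-pos l)) (s≤s l<k) (s≤s (<⇒≤ k<n))
                 (λ (_ , k≡n) → <⇒≢ k<n (suc-injective k≡n))
... | inj₂ refl = firstEdge-blue⇒α (trans (sym (π-leftBase g l r)) isBlue) , refl

π-α-split-reflected : ∀ g l r a c → arity l ≤ arity a → arity a < arity l + arity r →
  col (π (node g l r)) 1 (suc (arity a)) ≡ col (π (node α a c)) 1 (suc (arity a)) →
  g ≡ α × arity a ≡ arity l
π-α-split-reflected g l r a c l≤a a<n sameArc =
  π-node-blueFromOne g l r (arity a) l≤a a<n (trans sameArc (π-leftBase α a c))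

nf-injective : ∀ {n m} → NF n → NF m → arity n ≡ arity m → ArcsAgree (suc (arity n)) (π n) (π m) →
  n ≡ m
nf-injective nf-leaf    nf-leaf    _ _ = refl
nf-injective nf-leaf (nf-β {x} _)       e _ = contradiction e (leaf-arity≢node-arity β leaf x)
nf-injective nf-leaf (nf-α {a} {c} _ _) e _ = contradiction e (leaf-arity≢node-arity α a c)
nf-injective (nf-β {x} _)       nf-leaf e _ = contradiction (sym e) (leaf-arity≢node-arity β leaf x)
nf-injective (nf-α {a} {c} _ _) nf-leaf e _ = contradiction (sym e) (leaf-arity≢node-arity α a c)
nf-injective (nf-β {x} x-nf) (nf-β {y} y-nf) e agree =
  cong (node β leaf)
    (nf-injective x-nf y-nf (suc-injective e) (ArcsAgree-right β β leaf x leaf y refl (suc-injective e) agree))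
nf-injective (nf-β {x} _) (nf-α {a} {c} _ _) e agree =
  contradiction (proj₁ (π-α-split-reflected β leaf x a c (arity-pos a) a<n sameArc)) λ ()
  where
  a<n : arity a < 1 + arity x
  a<n = subst (arity a <_) (sym e) (m<m+n (arity a) (arity-pos c))
  sameArc : col (π (node β leaf x)) 1 (suc (arity a)) ≡ col (π (node α a c)) 1 (suc (arity a))
  sameArc = agree 1 _ ≤-refl (s≤s (arity-pos a)) (s≤s (<⇒≤ a<n))
nf-injective (nf-α {a} {c} _ _) (nf-β {x} _) e agree =
  contradiction (proj₁ (π-α-split-reflected β leaf x a c (arity-pos a) (subst (arity a <_) e a<n) sameArc)) λ ()
  where
  a<n : arity a < arity a + arity c
  a<n = m<m+n (arity a) (arity-pos c)
  sameArc : col (π (node β leaf x)) 1 (suc (arity a)) ≡ col (π (node α a c)) 1 (suc (arity a))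
  sameArc = sym (agree 1 _ ≤-refl (s≤s (arity-pos a)) (s≤s (<⇒≤ a<n)))
nf-injective (nf-α {a} {c} a-nf c-nf) (nf-α {a'} {c'} a'-nf c'-nf) e agree =
  cong₂ (node α) (nf-injective a-nf a'-nf a≡a' (ArcsAgree-left α α a c a' c' a≡a' agree))
                 (nf-injective c-nf c'-nf c≡c' (ArcsAgree-right α α a c a' c' a≡a' c≡c' agree))
  where
  a<n : arity a < arity a + arity c
  a<n = m<m+n (arity a) (arity-pos c)
  a'<n : arity a' < arity a + arity c
  a'<n = subst (arity a' <_) (sym e) (m<m+n (arity a') (arity-pos c'))
  a≡a' : arity a ≡ arity a'
  a≡a' with ≤-total (arity a) (arity a')
  ... | inj₁ a≤a' =
    sym (proj₂ (π-α-split-reflected α a c a' c' a≤a' a'<n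
                  (agree 1 _ ≤-refl (s≤s (arity-pos a')) (s≤s (<⇒≤ a'<n)))))
  ... | inj₂ a'≤a =
    proj₂ (π-α-split-reflected α a' c' a c a'≤a (subst (arity a <_) e a<n)
             (sym (agree 1 _ ≤-refl (s≤s (arity-pos a)) (s≤s (<⇒≤ a<n)))))
  c≡c' : arity c ≡ arity c'
  c≡c' = +-cancelˡ-≡ (arity a) (arity c) (arity c') (trans e (cong (_+ arity c') (sym a≡a')))

π-reflects-≈ : ∀ s t → π s ≐ π t → s ≈ t
π-reflects-≈ s t πs≐πt = ≈-trans (≈-sym (nf-≈ s)) (subst (_≈ t) (sym nf-s≡nf-t) (nf-≈ t))
  where
  πnf≐πnf : π (nf s) ≐ π (nf t)
  πnf≐πnf = ≐-trans (π-cong (nf-≈ s)) (≐-trans πs≐πt (≐-sym (π-cong (nf-≈ t))))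
  nf-s≡nf-t : nf s ≡ nf t
  nf-s≡nf-t = nf-injective (nf-NF s) (nf-NF t) (π-≐⇒arity-≡ (nf s) (nf t) πnf≐πnf)
                           (π-≐⇒ArcsAgree (nf s) (nf t) πnf≐πnf)

mainTheorem16 : ((t : Tree) → InGen (π t))
              × ((C : Colouring) → InGen C → ∃ λ t → π t ≐ C)
              × ((s t : Tree) → s ≈ t → π s ≐ π t)
              × ((s t : Tree) → π s ≐ π t → s ≈ t)
mainTheorem16 = π-inGen , inGen⇒π-image , (λ s t → π-cong) , π-reflects-≈
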